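{- Let $g$ be the $31$-uniform morphism $0\mapsto 0010100110010011001010011001011$, $1\mapsto 0010100101100101001100101001011$, $2\mapsto 0010011001011001010010110010011$. For any infinite squarefree word $\mathbf u$ over $\{0,1,2\}$, the word $g(\mathbf u)$ is $\tfrac52^+$-free, contains no pair of complementary factors of length $9$, and has exactly $40$ complementary factors (nonempty words $x$ such that both $x$ and $\overline{x}$ are factors of $g(\mathbf u)$).
   Context: $\overline{x}$ is obtained from a binary word $x$ by exchanging $0$ and $1$. A word is squarefree if it has no nonempty factor of the form $yy$. For a finite word $w$, $\exp(w)=|w|/\mathrm{per}(w)$ with $\mathrm{per}(w)$ its smallest period; a word is $\beta^+$-free if every nonempty factor has exponent $\le\beta$. -}

module Defs where

open import Data.Bool using (Bool; true; false; not)
open import Data.Nat using (ℕ; zero; suc; _+_; _*_; _≤_; _<_)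
open import Data.Nat.DivMod using (_/_; _%_; m%n<n)
open import Data.Fin using (Fin; fromℕ<) renaming (zero to f0; suc to fs)
open import Data.List using (List; []; _∷_; _++_; length; map)
open import Data.List.Relation.Unary.Unique.Propositional using (Unique)
open import Data.List.Membership.Propositional using (_∈_)
open import Data.Vec using (Vec; lookup) renaming ([] to []ᵥ; _∷_ to _∷ᵥ_)
open import Data.Empty using (⊥)
open import Data.Product using (Σ; ∃; _×_)
open import Relation.Nullary using (¬_)
open import Relation.Binary.PropositionalEquality using (_≡_; _≢_)
open import Function.Bundles using (_⇔_)

-- Infinite words over an alphabet A: functions ℕ → A.
-- Binary alphabet {0,1} is Bool with 0 = false, 1 = true; ternary alphabet {0,1,2} is Fin 3.

slice : {A : Set} → (ℕ → A) → ℕ → ℕ → List A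
slice w i zero    = []
slice w i (suc n) = w i ∷ slice w (suc i) n

Factor : {A : Set} → List A → (ℕ → A) → Set
Factor x w = ∃ λ i → slice w i (length x) ≡ x

SquareFree : {A : Set} → (ℕ → A) → Set
SquareFree w = ∀ y → y ≢ [] → ¬ Factor (y ++ y) w

_[_]=_ : {A : Set} → List A → ℕ → A → Set
[]      [ k ]= a = ⊥
(b ∷ x) [ zero ]= a = b ≡ a
(b ∷ x) [ suc k ]= a = x [ k ]= a

IsPeriod : {A : Set} → List A → ℕ → Set
IsPeriod w p = 1 ≤ p × (∀ k a b → k + p < length w → w [ k ]= a → w [ k + p ]= b → a ≡ b)

IsSmallestPeriod : {A : Set} → List A → ℕ → Set
IsSmallestPeriod w p = IsPeriod w p × (∀ q → IsPeriod w q → p ≤ q)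

-- exp(w) = |w|/per(w) ≤ a/b, written as b·|w| ≤ a·per(w)
ExpAtMost : {A : Set} → ℕ → ℕ → List A → Set
ExpAtMost a b w = ∀ p → IsSmallestPeriod w p → b * length w ≤ a * p

PlusFree : {A : Set} → ℕ → ℕ → (ℕ → A) → Set
PlusFree a b w = ∀ x → x ≢ [] → Factor x w → ExpAtMost a b x

compl : List Bool → List Bool
compl = map not

ComplFactor : List Bool → (ℕ → Bool) → Set
ComplFactor x w = x ≢ [] × Factor x w × Factor (compl x) w

private
  O I : Bool
  O = false
  I = true

g : Fin 3 → Vec Bool 31
g f0 = O ∷ᵥ O ∷ᵥ I ∷ᵥ O ∷ᵥ I ∷ᵥ O ∷ᵥ O ∷ᵥ I ∷ᵥ I ∷ᵥ O ∷ᵥ O ∷ᵥ I ∷ᵥ O ∷ᵥ O ∷ᵥ I ∷ᵥ I ∷ᵥ O ∷ᵥ O ∷ᵥ I ∷ᵥ O ∷ᵥ I ∷ᵥ O ∷ᵥ O ∷ᵥ I ∷ᵥ I ∷ᵥ O ∷ᵥ O ∷ᵥ I ∷ᵥ O ∷ᵥ I ∷ᵥ I ∷ᵥ []ᵥ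
g (fs f0) = O ∷ᵥ O ∷ᵥ I ∷ᵥ O ∷ᵥ I ∷ᵥ O ∷ᵥ O ∷ᵥ I ∷ᵥ O ∷ᵥ I ∷ᵥ I ∷ᵥ O ∷ᵥ O ∷ᵥ I ∷ᵥ O ∷ᵥ I ∷ᵥ O ∷ᵥ O ∷ᵥ I ∷ᵥ I ∷ᵥ O ∷ᵥ O ∷ᵥ I ∷ᵥ O ∷ᵥ I ∷ᵥ O ∷ᵥ O ∷ᵥ I ∷ᵥ O ∷ᵥ I ∷ᵥ I ∷ᵥ []ᵥ
g (fs (fs f0)) = O ∷ᵥ O ∷ᵥ I ∷ᵥ O ∷ᵥ O ∷ᵥ I ∷ᵥ I ∷ᵥ O ∷ᵥ O ∷ᵥ I ∷ᵥ O ∷ᵥ I ∷ᵥ I ∷ᵥ O ∷ᵥ O ∷ᵥ I ∷ᵥ O ∷ᵥ I ∷ᵥ O ∷ᵥ O ∷ᵥ I ∷ᵥ O ∷ᵥ I ∷ᵥ I ∷ᵥ O ∷ᵥ O ∷ᵥ I ∷ᵥ O ∷ᵥ O ∷ᵥ I ∷ᵥ I ∷ᵥ []ᵥ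

gImage : (ℕ → Fin 3) → (ℕ → Bool)
gImage u p = lookup (g (u (p / 31))) (fromℕ< (m%n<n p 31))

{-# OPTIONS --safe #-}
module Submission where

-- The morphism g is synchronising: for a ≠ b, a window of length 31 in g(ab) determines its offset
-- modulo 31 and, when that offset is at most 23, also the letter a. A repetition of exponent > 5/2
-- and period p ≥ 21 contains two equal windows at distance p, so 31 ∣ p, and comparing the windows
-- block by block turns it into a square of u. Periods p ≤ 20 are excluded by inspecting g(abc).
-- Every factor of length ≤ 9 is a prefix of one of the 25 factors of length 9 of some g(ab), so the
-- complementary factors are found by comparing prefixes of these 25 words; the 40 of them all occur,
-- with their complements, in g(1), and 1 occurs in every squarefree ternary word.

open import Defs
open import Data.Bool using (Bool; not)
import Data.Bool.Properties as Bool
open import Data.Empty using (⊥; ⊥-elim)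
open import Data.Fin using (Fin; #_)
import Data.Fin.Properties as Fin
open import Data.List using (List; []; _∷_; _++_; length; map; take)
open import Data.List.Properties using (length-++; length-map; length-take; take-map; ≡-dec)
open import Data.List.Relation.Unary.All as All using (All; all?)
open import Data.List.Relation.Unary.Unique.Propositional using (Unique)
open import Data.Nat using (ℕ; zero; suc; _+_; _*_; _∸_; _⊓_; _≤_; _<_; z≤n; s≤s; z<s; s<s; NonZero)
open import Data.Nat.DivMod
  using (_/_; _%_; m%n<n; m≡m%n+[m/n]*n; [m+kn]%n≡m%n; m*n%n≡0; m*n/n≡m; +-distrib-/-∣ʳ; m<n*o⇒m/o<n)
open import Data.Nat.Divisibility using (_∣_; divides; ∣m+n∣m⇒∣n)
open import Data.Nat.Properties
open import Algebra.Properties.CommutativeSemigroup +-commutativeSemigroup using (xy∙z≈xz∙y)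
open import Data.Nat.Tactic.RingSolver using (solve-∀)
open import Data.Product using (∃; _×_; _,_; proj₁; proj₂)
open import Data.String using (String; toList; fromChar)
import Data.String.Properties as String
open import Data.Sum using (_⊎_; inj₁; inj₂)
open import Data.Vec using (lookup)
open import Function using (_∘_; const)
open import Function.Bundles using (_⇔_; mk⇔)
open import Relation.Binary.Definitions using (DecidableEquality)
open import Relation.Binary.PropositionalEquality
  using (_≡_; _≢_; refl; sym; trans; cong; cong₂; subst; subst₂; module ≡-Reasoning)
open import Relation.Nullary using (¬_; Dec; yes; no; ¬?; contradiction)
open import Relation.Nullary.Decidable using (from-yes; _×-dec_; _⊎-dec_; _→-dec_)

_≟ʷ_ : DecidableEquality (List Bool)
_≟ʷ_ = ≡-dec Bool._≟_

open import Data.List.Membership.DecPropositional _≟ʷ_ using (_∈_; _∈?_)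
open import Data.List.Relation.Unary.Unique.DecPropositional _≟ʷ_ using (unique?)

infixr 5 _◂_

_◂_ : {A : Set} → A → (ℕ → A) → ℕ → A
(a ◂ v) zero    = a
(a ◂ v) (suc n) = v n

module _ {A : Set} where

  length-slice : ∀ (f : ℕ → A) i n → length (slice f i n) ≡ n
  length-slice f i zero    = refl
  length-slice f i (suc n) = cong suc (length-slice f (suc i) n)

  slice-ext : ∀ {f h : ℕ → A} i j n → (∀ {k} → k < n → f (i + k) ≡ h (j + k)) → slice f i n ≡ slice h j n
  slice-ext i j zero    _     = refl
  slice-ext {f} {h} i j (suc n) agree = cong₂ _∷_ first (slice-ext (suc i) (suc j) n rest)
    where
      first : f i ≡ h j
      first = subst₂ (λ a b → f a ≡ h b) (+-identityʳ i) (+-identityʳ j) (agree z<s)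

      rest : ∀ {k} → k < n → f (suc i + k) ≡ h (suc j + k)
      rest {k} k<n = subst₂ (λ a b → f a ≡ h b) (+-suc i k) (+-suc j k) (agree (s<s k<n))

  slice-lookup : ∀ (f : ℕ → A) i {n k} → k < n → slice f i n [ k ]= f (i + k)
  slice-lookup f i {suc n} {zero}  _         = cong f (sym (+-identityʳ i))
  slice-lookup f i {suc n} {suc k} (s<s k<n) =
    subst (slice f (suc i) n [ k ]=_) (cong f (sym (+-suc i k))) (slice-lookup f (suc i) k<n)

  slice-++ : ∀ (f : ℕ → A) i m n → slice f i (m + n) ≡ slice f i m ++ slice f (i + m) n
  slice-++ f i zero    n = cong (λ j → slice f j n) (sym (+-identityʳ i))
  slice-++ f i (suc m) n = cong (f i ∷_) (trans (slice-++ f (suc i) m n)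
    (cong (λ j → slice f (suc i) m ++ slice f j n) (sym (+-suc i m))))

  take-slice : ∀ (f : ℕ → A) i k n → take k (slice f i n) ≡ slice f i (k ⊓ n)
  take-slice f i zero    n       = refl
  take-slice f i (suc k) zero    = refl
  take-slice f i (suc k) (suc n) = cong (f i ∷_) (take-slice f (suc i) k n)

  factor-take : ∀ {x : List A} {w} k → Factor x w → Factor (take k x) w
  factor-take {x} {w} k (i , slice≡x) = i , (begin
    slice w i (length (take k x)) ≡⟨ cong (slice w i) (length-take k x) ⟩
    slice w i (k ⊓ length x)      ≡⟨ take-slice w i k (length x) ⟨
    take k (slice w i (length x)) ≡⟨ cong (take k) slice≡x ⟩
    take k x                      ∎)
    where open ≡-Reasoning

  ≢[]⇒1≤length : ∀ {x : List A} → x ≢ [] → 1 ≤ length x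
  ≢[]⇒1≤length {[]}    x≢[] = contradiction refl x≢[]
  ≢[]⇒1≤length {_ ∷ _} _    = s≤s z≤n

  -- w[i .. i + p + ⌊3p/2⌋] has period p, so its exponent exceeds 5/2.
  Repetition>5/2 : (ℕ → A) → ℕ → ℕ → Set
  Repetition>5/2 w i p = ∀ {k} → 2 * k ≤ 3 * p → w (i + k) ≡ w (i + k + p)

  repetition-slice : ∀ w i p → Repetition>5/2 w i p → ∀ c ℓ → 2 * (c + ℓ) ≤ 3 * p →
                     slice w (i + c) ℓ ≡ slice w (i + c + p) ℓ
  repetition-slice w i p rep c ℓ bound = slice-ext (i + c) (i + c + p) ℓ λ {t} t<ℓ → begin
    w (i + c + t)       ≡⟨ cong w (+-assoc i c t) ⟩
    w (i + (c + t))     ≡⟨ rep (≤-trans (*-monoʳ-≤ 2 (+-monoʳ-≤ c (<⇒≤ t<ℓ))) bound) ⟩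
    w (i + (c + t) + p) ≡⟨ cong w (trans (cong (_+ p) (sym (+-assoc i c t))) (xy∙z≈xz∙y (i + c) t p)) ⟩
    w (i + c + p + t)   ∎
    where open ≡-Reasoning

  repetitionFree⇒plusFree : ∀ {w} → (∀ i p → 1 ≤ p → ¬ Repetition>5/2 w i p) → PlusFree 5 2 w
  repetitionFree⇒plusFree {w} repetitionFree x _ (i , slice≡x) p ((1≤p , period) , _)
    with 2 * length x ≤? 5 * p
  ... | yes bounded  = bounded
  ... | no unbounded = ⊥-elim (repetitionFree i p 1≤p repetition)
    where
      at : ∀ {k} → k < length x → x [ k ]= w (i + k)
      at k<|x| = subst (_[ _ ]= _) slice≡x (slice-lookup w i k<|x|)

      repetition : Repetition>5/2 w i p
      repetition {k} 2k≤3p =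
        period k _ _ k+p<|x| (at (≤-<-trans (m≤m+n k p) k+p<|x|))
          (subst (x [ k + p ]=_) (cong w (sym (+-assoc i k p))) (at k+p<|x|))
        where
          open ≤-Reasoning
          k+p<|x| : k + p < length x
          k+p<|x| = *-cancelˡ-< 2 (k + p) (length x) (begin-strict
            2 * (k + p)   ≡⟨ *-distribˡ-+ 2 k p ⟩
            2 * k + 2 * p ≤⟨ +-monoˡ-≤ (2 * p) 2k≤3p ⟩
            3 * p + 2 * p ≡⟨ *-distribʳ-+ p 3 2 ⟨
            5 * p         <⟨ ≰⇒> unbounded ⟩
            2 * length x  ∎)

  squareFree⇒adjacent≢ : ∀ {u : ℕ → A} → SquareFree u → ∀ m → u m ≢ u (suc m)
  squareFree⇒adjacent≢ {u} squareFree m um≡um+1 =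
    squareFree (u m ∷ []) (λ ()) (m , cong (λ b → u m ∷ b ∷ []) (sym um≡um+1))

  squareFree⇒noSquare : ∀ {u : ℕ → A} → SquareFree u → ∀ {m n} → slice u m n ≡ slice u (m + n) n → n ≡ 0
  squareFree⇒noSquare squareFree {n = zero} _ = refl
  squareFree⇒noSquare {u} squareFree {m} {suc n} halves = contradiction (m , square) (squareFree y λ ())
    where
      open ≡-Reasoning
      y : List A
      y = slice u m (suc n)

      square : slice u m (length (y ++ y)) ≡ y ++ y
      square = begin
        slice u m (length (y ++ y))      ≡⟨ cong (slice u m) (trans (length-++ y)
                                              (cong₂ _+_ (length-slice u m (suc n)) (length-slice u m (suc n)))) ⟩
        slice u m (suc n + suc n)        ≡⟨ slice-++ u m (suc n) (suc n) ⟩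
        y ++ slice u (m + suc n) (suc n) ≡⟨ cong (y ++_) halves ⟨
        y ++ y                           ∎

squareFree₄-allLetters : ∀ (a b c d : Fin 3) → a ≢ b → b ≢ c → c ≢ d → ¬ (a ≡ c × b ≡ d) →
                         ∀ x → a ≡ x ⊎ b ≡ x ⊎ c ≡ x ⊎ d ≡ x
squareFree₄-allLetters = from-yes (
  Fin.all? λ (a : Fin 3) → Fin.all? λ b → Fin.all? λ c → Fin.all? λ d →
    ¬? (a Fin.≟ b) →-dec ¬? (b Fin.≟ c) →-dec ¬? (c Fin.≟ d) →-dec ¬? (a Fin.≟ c ×-dec b Fin.≟ d) →-dec
    Fin.all? λ x → a Fin.≟ x ⊎-dec b Fin.≟ x ⊎-dec c Fin.≟ x ⊎-dec d Fin.≟ x)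

squareFree⇒letterOccurs : ∀ {u : ℕ → Fin 3} → SquareFree u → ∀ a → ∃ λ m → u m ≡ a
squareFree⇒letterOccurs {u} squareFree a =
  position (squareFree₄-allLetters (u 0) (u 1) (u 2) (u 3) (adjacent 0) (adjacent 1) (adjacent 2) noSquare a)
  where
    adjacent : ∀ m → u m ≢ u (suc m)
    adjacent = squareFree⇒adjacent≢ squareFree

    noSquare : ¬ (u 0 ≡ u 2 × u 1 ≡ u 3)
    noSquare (e₀ , e₁) = contradiction (squareFree⇒noSquare squareFree {0} {2} (cong₂ (λ x y → x ∷ y ∷ []) e₀ e₁)) λ ()

    position : u 0 ≡ a ⊎ u 1 ≡ a ⊎ u 2 ≡ a ⊎ u 3 ≡ a → ∃ λ m → u m ≡ a
    position (inj₁ e)               = 0 , e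
    position (inj₂ (inj₁ e))        = 1 , e
    position (inj₂ (inj₂ (inj₁ e))) = 2 , e
    position (inj₂ (inj₂ (inj₂ e))) = 3 , e

[m+kn]/n≡m/n+k : ∀ m k n .{{_ : NonZero n}} → (m + k * n) / n ≡ m / n + k
[m+kn]/n≡m/n+k m k n = trans (+-distrib-/-∣ʳ m (divides k refl)) (cong (m / n +_) (m*n/n≡m k n))

m%n≡[m+p]%n⇒n∣p : ∀ m p n .{{_ : NonZero n}} → m % n ≡ (m + p) % n → n ∣ p
m%n≡[m+p]%n⇒n∣p m p n sameOffset = ∣m+n∣m⇒∣n (divides ((m + p) / n) blocks) (divides (m / n) refl)
  where
    open ≡-Reasoning
    blocks : m / n * n + p ≡ (m + p) / n * n
    blocks = +-cancelˡ-≡ (m % n) _ _ (begin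
      m % n + (m / n * n + p)       ≡⟨ +-assoc (m % n) _ p ⟨
      m % n + m / n * n + p         ≡⟨ cong (_+ p) (m≡m%n+[m/n]*n m n) ⟨
      m + p                         ≡⟨ m≡m%n+[m/n]*n (m + p) n ⟩
      (m + p) % n + (m + p) / n * n ≡⟨ cong (_+ (m + p) / n * n) sameOffset ⟨
      m % n + (m + p) / n * n       ∎)

offset≤23 : ∀ i → ∃ λ d → d ≤ 7 × (i + d) % 31 ≤ 23
offset≤23 i with i % 31 ≤? 23
... | yes r≤23 = 0 , z≤n , subst (λ j → j % 31 ≤ 23) (sym (+-identityʳ i)) r≤23
... | no  r≰23 = 31 ∸ i % 31 , ∸-monoʳ-≤ 31 (≰⇒> r≰23) , subst (_≤ 23) (sym nextBlock) z≤n
  where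
    open ≡-Reasoning
    nextBlock : (i + (31 ∸ i % 31)) % 31 ≡ 0
    nextBlock = begin
      (i + (31 ∸ i % 31)) % 31                    ≡⟨ cong (λ j → (j + (31 ∸ i % 31)) % 31) (m≡m%n+[m/n]*n i 31) ⟩
      (i % 31 + i / 31 * 31 + (31 ∸ i % 31)) % 31 ≡⟨ cong (_% 31) (xy∙z≈xz∙y (i % 31) _ _) ⟩
      (i % 31 + (31 ∸ i % 31) + i / 31 * 31) % 31 ≡⟨ cong (λ j → (j + i / 31 * 31) % 31) (m+[n∸m]≡n (<⇒≤ (m%n<n i 31))) ⟩
      suc (i / 31) * 31 % 31                      ≡⟨ m*n%n≡0 (suc (i / 31)) 31 ⟩
      0                                           ∎

block-bound : ∀ {d s q} → d ≤ 7 → s < q → 2 * (d + s * 31 + 31) ≤ 3 * (q * 31)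
block-bound {d} {s} {q} d≤7 s<q = begin
  2 * (d + s * 31 + 31) ≤⟨ *-monoʳ-≤ 2 (+-monoˡ-≤ 31 (+-monoˡ-≤ (s * 31) d≤7)) ⟩
  2 * (7 + s * 31 + 31) ≡⟨ expandˡ s ⟩
  76 + s * 62           ≤⟨ +-mono-≤ (m≤m+n 76 17) (*-monoʳ-≤ s (m≤m+n 62 31)) ⟩
  93 + s * 93           ≡⟨ expandʳ s ⟨
  3 * (suc s * 31)      ≤⟨ *-monoʳ-≤ 3 (*-monoˡ-≤ 31 s<q) ⟩
  3 * (q * 31)          ∎
  where
    open ≤-Reasoning
    expandˡ : ∀ s → 2 * (7 + s * 31 + 31) ≡ 76 + s * 62
    expandˡ = solve-∀
    expandʳ : ∀ s → 3 * (suc s * 31) ≡ 93 + s * 93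
    expandʳ = solve-∀

gImage-cong : ∀ {u v m n} → u (m / 31) ≡ v (n / 31) → m % 31 ≡ n % 31 → gImage u m ≡ gImage v n
gImage-cong {m = m} {n} sameLetter sameOffset =
  cong₂ lookup (cong g sameLetter) (Fin.fromℕ<-cong _ _ sameOffset (m%n<n m 31) (m%n<n n 31))

gImage-shift : ∀ {u v} b {m x} → (∀ {n} → n < b → u (n + m) ≡ v n) → x < b * 31 →
               gImage u (x + m * 31) ≡ gImage v x
gImage-shift {u} {v} b {m} {x} agree x<b*31 = gImage-cong {u} {v} {x + m * 31} {x}
  (trans (cong u ([m+kn]/n≡m/n+k x m 31)) (agree (m<n*o⇒m/o<n x<b*31))) ([m+kn]%n≡m%n x m 31)

gImage-local : ∀ {u v} b i {k} → (∀ {n} → n < b → u (n + i / 31) ≡ v n) → i % 31 + k < b * 31 →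
               gImage u (i + k) ≡ gImage v (i % 31 + k)
gImage-local {u} {v} b i {k} agree bound = begin
  gImage u (i + k)                    ≡⟨ cong (λ j → gImage u (j + k)) (m≡m%n+[m/n]*n i 31) ⟩
  gImage u (i % 31 + i / 31 * 31 + k) ≡⟨ cong (gImage u) (xy∙z≈xz∙y (i % 31) _ k) ⟩
  gImage u (i % 31 + k + i / 31 * 31) ≡⟨ gImage-shift {u} {v} b agree bound ⟩
  gImage v (i % 31 + k)               ∎
  where open ≡-Reasoning

slice-gImage-local : ∀ {u v} b i ℓ → (∀ {n} → n < b → u (n + i / 31) ≡ v n) → i % 31 + ℓ ≤ b * 31 →
                     slice (gImage u) i ℓ ≡ slice (gImage v) (i % 31) ℓ
slice-gImage-local {u} {v} b i ℓ agree bound =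
  slice-ext i (i % 31) ℓ λ k<ℓ → gImage-local {u} {v} b i agree (<-≤-trans (+-monoʳ-< (i % 31) k<ℓ) bound)

-- g(a b b b …) and g(a b c c …): only the prefixes g(ab) and g(abc) are ever read.
pairImage : Fin 3 → Fin 3 → ℕ → Bool
pairImage a b = gImage (a ◂ const b)

tripleImage : Fin 3 → Fin 3 → Fin 3 → ℕ → Bool
tripleImage a b c = gImage (a ◂ b ◂ const c)

pairImage-synchronising : ∀ a b a' b' → a ≢ b → a' ≢ b' → ∀ {r} → r < 31 → ∀ {r'} → r' < 31 →
  slice (pairImage a b) r 31 ≡ slice (pairImage a' b') r' 31 → r ≡ r' × (r ≤ 23 → a ≡ a')
pairImage-synchronising = from-yes (
  Fin.all? λ a → Fin.all? λ b → Fin.all? λ a' → Fin.all? λ b' → ¬? (a Fin.≟ b) →-dec ¬? (a' Fin.≟ b') →-dec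
    allUpTo? (λ r → allUpTo? (λ r' →
      slice (pairImage a b) r 31 ≟ʷ slice (pairImage a' b') r' 31 →-dec (r ≟ r' ×-dec (r ≤? 23 →-dec a Fin.≟ a'))) 31) 31)

tripleImage-noShortRepetition : ∀ a b c → a ≢ b → b ≢ c → ∀ {r} → r < 31 → ∀ {p} → p < 21 → 1 ≤ p →
  ¬ (∀ {k} → k < 31 → 2 * k ≤ 3 * p → tripleImage a b c (r + k) ≡ tripleImage a b c (r + (k + p)))
tripleImage-noShortRepetition = from-yes (
  Fin.all? λ a → Fin.all? λ b → Fin.all? λ c → ¬? (a Fin.≟ b) →-dec ¬? (b Fin.≟ c) →-dec
    allUpTo? (λ r → allUpTo? (λ p → 1 ≤? p →-dec ¬? (allUpTo? (λ k →
      2 * k ≤? 3 * p →-dec tripleImage a b c (r + k) Bool.≟ tripleImage a b c (r + (k + p))) 31)) 21) 31)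

bits : String → List Bool
bits = map (λ c → fromChar c String.== "1") ∘ toList

length9Factors : List (List Bool)
length9Factors = map bits
  ( "001001100" ∷ "001010010" ∷ "001010011" ∷ "001011001" ∷ "001100100" ∷ "001100101" ∷ "010010110"
  ∷ "010011001" ∷ "010100101" ∷ "010100110" ∷ "010110010" ∷ "011001001" ∷ "011001010" ∷ "011001011"
  ∷ "100100110" ∷ "100101001" ∷ "100101100" ∷ "100110010" ∷ "101001011" ∷ "101001100" ∷ "101100100"
  ∷ "101100101" ∷ "110010011" ∷ "110010100" ∷ "110010110" ∷ [])

pairImage-factors₉ : ∀ a b → a ≢ b → ∀ {r} → r < 31 → slice (pairImage a b) r 9 ∈ length9Factors
pairImage-factors₉ = from-yes (
  Fin.all? λ a → Fin.all? λ b → ¬? (a Fin.≟ b) →-dec allUpTo? (λ r → slice (pairImage a b) r 9 ∈? length9Factors) 31)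

complementaryFactors : List (List Bool)
complementaryFactors = map bits
  ( "0" ∷ "1" ∷ "00" ∷ "01" ∷ "10" ∷ "11"
  ∷ "001" ∷ "010" ∷ "011" ∷ "100" ∷ "101" ∷ "110"
  ∷ "0011" ∷ "0100" ∷ "0101" ∷ "0110" ∷ "1001" ∷ "1010" ∷ "1011" ∷ "1100"
  ∷ "00110" ∷ "01001" ∷ "01011" ∷ "01100" ∷ "10011" ∷ "10100" ∷ "10110" ∷ "11001"
  ∷ "010011" ∷ "010110" ∷ "011001" ∷ "100110" ∷ "101001" ∷ "101100"
  ∷ "0100110" ∷ "0101100" ∷ "1010011" ∷ "1011001"
  ∷ "01011001" ∷ "10100110" ∷ [])

ComplementaryPrefixes : List Bool → List Bool → Set
ComplementaryPrefixes x y =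
  ∀ {ℓ} → ℓ < 10 → 1 ≤ ℓ → compl (take ℓ x) ≡ take ℓ y → take ℓ x ∈ complementaryFactors

length9Factors-complementaryPrefixes : All (λ x → All (ComplementaryPrefixes x) length9Factors) length9Factors
length9Factors-complementaryPrefixes = from-yes (all? (λ x → all? (λ y → allUpTo? (λ ℓ → 1 ≤? ℓ →-dec
  (compl (take ℓ x) ≟ʷ take ℓ y →-dec take ℓ x ∈? complementaryFactors)) 10) length9Factors) length9Factors)

OccursIn : Fin 3 → List Bool → Set
OccursIn a x = ∃ λ r → r < 31 × r + length x ≤ 31 × slice (gImage (const a)) r (length x) ≡ x

occursIn? : ∀ a x → Dec (OccursIn a x)
occursIn? a x = anyUpTo? (λ r → r + length x ≤? 31 ×-dec slice (gImage (const a)) r (length x) ≟ʷ x) 31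

complementaryFactors-in-g1 : All (λ x → OccursIn (# 1) x × OccursIn (# 1) (compl x)) complementaryFactors
complementaryFactors-in-g1 =
  from-yes (all? (λ x → occursIn? (# 1) x ×-dec occursIn? (# 1) (compl x)) complementaryFactors)

complementaryFactors-shape : All (λ x → x ≢ [] × length x ≤ 8) complementaryFactors
complementaryFactors-shape = from-yes (all? (λ x → ¬? (x ≟ʷ []) ×-dec length x ≤? 8) complementaryFactors)

complementaryFactors-unique : Unique complementaryFactors
complementaryFactors-unique = from-yes (unique? complementaryFactors)

module _ {u : ℕ → Fin 3} (squareFree : SquareFree u) where

  private
    w : ℕ → Bool
    w = gImage u

    adjacent : ∀ m → u m ≢ u (suc m)
    adjacent = squareFree⇒adjacent≢ squareFree

  slice-pairImage : ∀ i {ℓ} → ℓ ≤ 31 → slice w i ℓ ≡ slice (pairImage (u (i / 31)) (u (suc (i / 31)))) (i % 31) ℓ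
  slice-pairImage i {ℓ} ℓ≤31 = slice-gImage-local {u} 2 i ℓ letters (+-mono-≤ (<⇒≤ (m%n<n i 31)) ℓ≤31)
    where
      letters : ∀ {n} → n < 2 → u (n + i / 31) ≡ (u (i / 31) ◂ const (u (suc (i / 31)))) n
      letters {0}           _                 = refl
      letters {1}           _                 = refl
      letters {suc (suc _)} (s≤s (s≤s ()))

  synchronise : ∀ i j → slice w i 31 ≡ slice w j 31 → i % 31 ≡ j % 31 × (i % 31 ≤ 23 → u (i / 31) ≡ u (j / 31))
  synchronise i j same =
    pairImage-synchronising _ _ _ _ (adjacent (i / 31)) (adjacent (j / 31)) (m%n<n i 31) (m%n<n j 31)
      (trans (sym (slice-pairImage i ≤-refl)) (trans same (slice-pairImage j ≤-refl)))

  shortRepetitionFree : ∀ i p → 1 ≤ p → p ≤ 20 → ¬ Repetition>5/2 w i p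
  shortRepetitionFree i p 1≤p p≤20 rep =
    tripleImage-noShortRepetition _ _ _ (adjacent m) (adjacent (suc m)) (m%n<n i 31) (s≤s p≤20) 1≤p agree
    where
      m : ℕ
      m = i / 31

      v : ℕ → Bool
      v = tripleImage (u m) (u (suc m)) (u (2 + m))

      letters : ∀ {n} → n < 3 → u (n + m) ≡ (u m ◂ u (suc m) ◂ const (u (2 + m))) n
      letters {0}                 _                     = refl
      letters {1}                 _                     = refl
      letters {2}                 _                     = refl
      letters {suc (suc (suc _))} (s≤s (s≤s (s≤s ())))

      local : ∀ {k} → k < 63 → w (i + k) ≡ v (i % 31 + k)
      local k<63 = gImage-local {u} 3 i letters (+-mono-≤-< (≤-pred (m%n<n i 31)) k<63)

      agree : ∀ {k} → k < 31 → 2 * k ≤ 3 * p → v (i % 31 + k) ≡ v (i % 31 + (k + p))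
      agree {k} k<31 2k≤3p = begin
        v (i % 31 + k)       ≡⟨ local (≤-trans k<31 (m≤m+n 31 32)) ⟨
        w (i + k)            ≡⟨ rep 2k≤3p ⟩
        w (i + k + p)        ≡⟨ cong w (+-assoc i k p) ⟩
        w (i + (k + p))      ≡⟨ local (<-≤-trans (+-mono-<-≤ k<31 p≤20) (m≤m+n 51 12)) ⟩
        v (i % 31 + (k + p)) ∎
        where open ≡-Reasoning

  repetition-period : ∀ i p → 21 ≤ p → Repetition>5/2 w i p → 31 ∣ p
  repetition-period i p 21≤p rep = m%n≡[m+p]%n⇒n∣p (i + 0) p 31
    (proj₁ (synchronise (i + 0) (i + 0 + p) (repetition-slice w i p rep 0 31 (<⇒≤ (*-monoʳ-≤ 3 21≤p)))))

  repetition⇒square : ∀ i q {d} → Repetition>5/2 w i (q * 31) → d ≤ 7 → (i + d) % 31 ≤ 23 →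
                      slice u ((i + d) / 31) q ≡ slice u ((i + d) / 31 + q) q
  repetition⇒square i q {d} rep d≤7 early = slice-ext M (M + q) q block
    where
      open ≡-Reasoning
      M : ℕ
      M = (i + d) / 31

      block : ∀ {s} → s < q → u (M + s) ≡ u (M + q + s)
      block {s} s<q = begin
        u (M + s)                          ≡⟨ cong u ([m+kn]/n≡m/n+k (i + d) s 31) ⟨
        u ((i + d + s * 31) / 31)          ≡⟨ proj₂ (synchronise (i + d + s * 31) (i + d + s * 31 + q * 31) windows) offset ⟩
        u ((i + d + s * 31 + q * 31) / 31) ≡⟨ cong u nextBlock ⟩
        u (M + q + s)                      ∎
        where
          windows : slice w (i + d + s * 31) 31 ≡ slice w (i + d + s * 31 + q * 31) 31
          windows = subst (λ j → slice w j 31 ≡ slice w (j + q * 31) 31) (sym (+-assoc i d (s * 31)))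
            (repetition-slice w i (q * 31) rep (d + s * 31) 31 (block-bound d≤7 s<q))

          offset : (i + d + s * 31) % 31 ≤ 23
          offset = subst (_≤ 23) (sym ([m+kn]%n≡m%n (i + d) s 31)) early

          nextBlock : (i + d + s * 31 + q * 31) / 31 ≡ M + q + s
          nextBlock = begin
            (i + d + s * 31 + q * 31) / 31   ≡⟨ cong (_/ 31) (+-assoc (i + d) (s * 31) (q * 31)) ⟩
            (i + d + (s * 31 + q * 31)) / 31 ≡⟨ cong (λ n → (i + d + n) / 31) (*-distribʳ-+ 31 s q) ⟨
            (i + d + (s + q) * 31) / 31      ≡⟨ [m+kn]/n≡m/n+k (i + d) (s + q) 31 ⟩
            M + (s + q)                      ≡⟨ cong (M +_) (+-comm s q) ⟩
            M + (q + s)                      ≡⟨ +-assoc M q s ⟨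
            M + q + s                        ∎

  longRepetitionFree : ∀ i p → 21 ≤ p → ¬ Repetition>5/2 w i p
  longRepetitionFree i p 21≤p rep = noSquare (offset≤23 i)
    where
      period : 31 ∣ p
      period = repetition-period i p 21≤p rep

      q : ℕ
      q = _∣_.quotient period

      q≢0 : q ≢ 0
      q≢0 q≡0 = contradiction (subst (21 ≤_) (trans (_∣_.equality period) (cong (_* 31) q≡0)) 21≤p) λ ()

      noSquare : (∃ λ d → d ≤ 7 × (i + d) % 31 ≤ 23) → ⊥
      noSquare (d , d≤7 , early) = q≢0 (squareFree⇒noSquare squareFree {n = q}
        (repetition⇒square i q (subst (Repetition>5/2 w i) (_∣_.equality period) (λ {k} → rep {k})) d≤7 early))

  repetitionFree : ∀ i p → 1 ≤ p → ¬ Repetition>5/2 w i p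
  repetitionFree i p 1≤p with p ≤? 20
  ... | yes p≤20 = shortRepetitionFree i p 1≤p p≤20
  ... | no  p≰20 = longRepetitionFree i p (≰⇒> p≰20)

  factor-prefix₉ : ∀ {x} → Factor x w → length x ≤ 9 → ∃ λ X → X ∈ length9Factors × take (length x) X ≡ x
  factor-prefix₉ {x} (i , slice≡x) |x|≤9 = slice w i 9 , factor₉ , (begin
    take (length x) (slice w i 9) ≡⟨ take-slice w i (length x) 9 ⟩
    slice w i (length x ⊓ 9)      ≡⟨ cong (slice w i) (m≤n⇒m⊓n≡m |x|≤9) ⟩
    slice w i (length x)          ≡⟨ slice≡x ⟩
    x                             ∎)
    where
      open ≡-Reasoning
      factor₉ : slice w i 9 ∈ length9Factors
      factor₉ = subst (_∈ length9Factors) (sym (slice-pairImage i (m≤m+n 9 22)))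
        (pairImage-factors₉ _ _ (adjacent (i / 31)) (m%n<n i 31))

  shortComplementary⇒listed : ∀ {x} → ComplFactor x w → length x ≤ 9 → x ∈ complementaryFactors
  shortComplementary⇒listed {x} (x≢[] , fx , fcx) |x|≤9 =
    listed (factor-prefix₉ fx |x|≤9) (factor-prefix₉ fcx (subst (_≤ 9) (sym (length-map not x)) |x|≤9))
    where
      open ≡-Reasoning
      Prefix : List Bool → Set
      Prefix y = ∃ λ Y → Y ∈ length9Factors × take (length y) Y ≡ y

      listed : Prefix x → Prefix (compl x) → x ∈ complementaryFactors
      listed (X , X∈ , X≡) (Y , Y∈ , Y≡) = subst (_∈ complementaryFactors) X≡
        (All.lookup (All.lookup length9Factors-complementaryPrefixes X∈) Y∈ (s≤s |x|≤9) (≢[]⇒1≤length x≢[]) complPrefix)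
        where
          complPrefix : compl (take (length x) X) ≡ take (length x) Y
          complPrefix = begin
            compl (take (length x) X) ≡⟨ cong compl X≡ ⟩
            compl x                   ≡⟨ Y≡ ⟨
            take (length (compl x)) Y ≡⟨ cong (λ n → take n Y) (length-map not x) ⟩
            take (length x) Y         ∎

  noComplementary₉ : ∀ x → length x ≡ 9 → ¬ (Factor x w × Factor (compl x) w)
  noComplementary₉ []          ()
  noComplementary₉ x@(_ ∷ _) |x|≡9 (fx , fcx) =
    <⇒≱ (≤-reflexive (sym |x|≡9)) (proj₂ (All.lookup complementaryFactors-shape listed))
    where
      listed : x ∈ complementaryFactors
      listed = shortComplementary⇒listed ((λ ()) , fx , fcx) (≤-reflexive |x|≡9)

  complementary⇒listed : ∀ {x} → ComplFactor x w → x ∈ complementaryFactors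
  complementary⇒listed {x} complementary@(_ , fx , fcx) = byLength (length x ≤? 9)
    where
      byLength : Dec (length x ≤ 9) → x ∈ complementaryFactors
      byLength (yes |x|≤9) = shortComplementary⇒listed complementary |x|≤9
      byLength (no  |x|≰9) =
        contradiction (factor-take 9 fx , subst (λ y → Factor y w) (take-map 9 x) (factor-take 9 fcx))
          (noComplementary₉ (take 9 x) (trans (length-take 9 x) (m≤n⇒m⊓n≡m (<⇒≤ (≰⇒> |x|≰9)))))

  occursIn⇒factor : ∀ {m a x} → u m ≡ a → OccursIn a x → Factor x w
  occursIn⇒factor {m} {a} {x} um≡a (r , _ , fits , slice≡x) =
    r + m * 31 , trans (slice-ext (r + m * 31) r (length x) inBlock) slice≡x
    where
      letter : ∀ {n} → n < 1 → u (n + m) ≡ a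
      letter {zero}  _         = um≡a
      letter {suc _} (s≤s ())

      inBlock : ∀ {k} → k < length x → w (r + m * 31 + k) ≡ gImage (const a) (r + k)
      inBlock {k} k<|x| = trans (cong w (xy∙z≈xz∙y r (m * 31) k))
        (gImage-shift {u} {const a} 1 letter (<-≤-trans (+-monoʳ-< r k<|x|) fits))

  listed⇒complementary : ∀ {x} → x ∈ complementaryFactors → ComplFactor x w
  listed⇒complementary {x} x∈ =
    complementary (squareFree⇒letterOccurs squareFree (# 1)) (All.lookup complementaryFactors-in-g1 x∈)
    where
      complementary : (∃ λ m → u m ≡ # 1) → OccursIn (# 1) x × OccursIn (# 1) (compl x) → ComplFactor x w
      complementary (m , um≡1) (occurs , occursCompl) =
        proj₁ (All.lookup complementaryFactors-shape x∈) , occursIn⇒factor um≡1 occurs , occursIn⇒factor um≡1 occursCompl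

theorem20 : (u : ℕ → Fin 3) → SquareFree u →
    PlusFree 5 2 (gImage u)
    × (∀ (x : List Bool) → length x ≡ 9 → ¬ (Factor x (gImage u) × Factor (compl x) (gImage u)))
    × (∃ λ (L : List (List Bool)) → length L ≡ 40 × Unique L
    × (∀ x → (x ∈ L) ⇔ ComplFactor x (gImage u)))
theorem20 u squareFree =
    repetitionFree⇒plusFree (repetitionFree squareFree)
  , noComplementary₉ squareFree
  , complementaryFactors , refl , complementaryFactors-unique
  , λ x → mk⇔ (listed⇒complementary squareFree) (complementary⇒listed squareFree)
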